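{- Let $\mu\vdash n$ and $a=(a_1,\dots,a_h)\vDash n$ with $\mu\unrhd\lambda(a)$. Assume $a_h\ge2$, $r\in R(\mu,a)$ and $r\le s(\mu,a)$. Then $s(\mu,a)\le s(\mu^{(r)},\tilde a)$. In particular, $R(\mu^{(r)},\tilde a,r)\ne\emptyset$ and $l(\mu^{(r)},\tilde a,r)\le s(\mu^{(r)},\tilde a)$.
   Context: A composition $a\vDash n$ is a sequence of positive integers summing to $n$; a partition $\mu=(\mu_1,\dots,\mu_k)\vdash n$ is a non-increasing composition, with $\mu_i=0$ for $i>k$ and trailing zeros deleted. For compositions $a=(a_1,\dots,a_h)$, $b=(b_1,\dots,b_k)$ of $n$, $a\unrhd b$ means $k\ge h$ and $\sum_{i=1}^j a_i\ge\sum_{i=1}^jb_i$ for $j=1,\dots,h$. $\lambda(a)$ is the non-increasing rearrangement of $a$; $\tilde a=(a_1,\dots,a_{h-1},a_h-1)$ if $a_h\ge2$ and $\tilde a=(a_1,\dots,a_{h-1})$ if $a_h=1$. $\mu^{(i)}$ is $\mu$ with its $i$-th entry decreased by $1$. For a partition $\nu=(\nu_1,\dots,\nu_m)$ and composition $b$ of the same integer with last part $b_{h(b)}$: $s(\nu,b)=\max\{i:1\le i\le m,\ \nu_i\ge b_{h(b)}\}$; $R(\nu,b)$ is the set of $i\in\{1,\dots,m\}$ with $\nu_i>\nu_{i+1}$ and $\nu^{(i)}\unrhd\lambda(\tilde b)$; $R(\nu,b,i)=\{r\in R(\nu,b):r\ge i\}$ and $l(\nu,b,i)=\min R(\nu,b,i)$.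 -}

module Defs where

open import Data.Nat using (ℕ; zero; suc; _+_; _∸_; _≤_; _<_; _≥_; _≤ᵇ_; _⊔_)
open import Data.Bool using (if_then_else_)
open import Data.List using (List; []; _∷_; length; take; foldr; map; applyUpTo)
open import Data.Nat.ListAction using (sum)
open import Data.List.Relation.Unary.All using (All)
open import Data.List.Relation.Unary.Linked using (Linked)
open import Data.Product using (_×_)
open import Relation.Binary.PropositionalEquality using (_≡_)

-- Sequences are lists of naturals, read 1-indexed, with entries beyond the end = 0.

IsComposition : ℕ → List ℕ → Set
IsComposition n a = All (0 <_) a × sum a ≡ n

IsPartition : ℕ → List ℕ → Set
IsPartition n μ = IsComposition n μ × Linked _≥_ μ

at : List ℕ → ℕ → ℕ
at []       _             = 0
at (x ∷ xs) zero          = 0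
at (x ∷ xs) (suc zero)    = x
at (x ∷ xs) (suc (suc i)) = at xs (suc i)

lastPart : List ℕ → ℕ
lastPart []           = 0
lastPart (x ∷ [])     = x
lastPart (x ∷ y ∷ ys) = lastPart (y ∷ ys)

_⊵_ : List ℕ → List ℕ → Set
a ⊵ b = length a ≤ length b ×
        (∀ j → 1 ≤ j → j ≤ length a → sum (take j b) ≤ sum (take j a))

insertDesc : ℕ → List ℕ → List ℕ
insertDesc x []       = x ∷ []
insertDesc x (y ∷ ys) = if y ≤ᵇ x then x ∷ y ∷ ys else y ∷ insertDesc x ys

sortDesc : List ℕ → List ℕ
sortDesc = foldr insertDesc []

tilde : List ℕ → List ℕ
tilde []               = []
tilde (suc zero ∷ [])  = []
tilde (x ∷ [])         = (x ∸ 1) ∷ []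
tilde (x ∷ y ∷ ys)     = x ∷ tilde (y ∷ ys)

trim : List ℕ → List ℕ
trim [] = []
trim (x ∷ xs) with trim xs
... | [] = if x ≤ᵇ 0 then [] else x ∷ []
... | y ∷ ys = x ∷ y ∷ ys

decRaw : List ℕ → ℕ → List ℕ
decRaw []       _             = []
decRaw (x ∷ xs) zero          = x ∷ xs
decRaw (x ∷ xs) (suc zero)    = (x ∸ 1) ∷ xs
decRaw (x ∷ xs) (suc (suc i)) = x ∷ decRaw xs (suc i)

dec : List ℕ → ℕ → List ℕ
dec μ i = trim (decRaw μ i)

-- s(ν,b) = max{ i : 1 ≤ i ≤ m, ν_i ≥ b_{h(b)} }  (0 if the set is empty)
sIdx : List ℕ → List ℕ → ℕ
sIdx ν b = foldr _⊔_ 0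
  (map (λ i → if lastPart b ≤ᵇ at ν i then i else 0) (applyUpTo suc (length ν)))

InR : List ℕ → List ℕ → ℕ → Set
InR ν b i = 1 ≤ i × i ≤ length ν × at ν (suc i) < at ν i
          × dec ν i ⊵ sortDesc (tilde b)

IsMinR : List ℕ → List ℕ → ℕ → ℕ → Set
IsMinR ν b i l = (InR ν b l × i ≤ l) × (∀ r → InR ν b r → i ≤ r → l ≤ r)

-- Put ν = μ^(r), b = ã, c = b_{h(b)} = a_h − 1 and s′ = s(ν, b). At s = s(μ, a) we have μ_s ≥ a_h,
-- hence ν_s ≥ c and s ≤ s′. As R(ν, b) is decidable and r ≤ s′, the second claim reduces to
-- s′ ∈ R(ν, b). There ν_{s′} ≥ c > ν_{s′+1}, and after sorting, b ↦ b̃ lowers a part of λ(b) of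
-- size c by one. Up to position s′ the prefix sums of ν^(s′) are those of ν; beyond it they are
-- one less, but there every part of ν is below c, so the prefix sums of ν exceed those of λ(b)
-- strictly unless the lowered part lies behind, and either way those of λ(b̃) fit under ν^(s′).
module Submission where

open import Defs
open import Data.Nat
open import Data.Nat.Properties
open import Data.Nat.ListAction using (sum)
open import Algebra.Properties.CommutativeSemigroup +-commutativeSemigroup using (x∙yz≈y∙xz)
open import Data.Bool using (true; false; if_then_else_)
open import Data.List using (List; []; _∷_; length; take; applyUpTo)
open import Data.List.Properties using (take-all; foldr-preservesᵇ; foldr-preservesᵒ)
open import Data.List.Relation.Unary.All using (All; []; _∷_; all?)
import Data.List.Relation.Unary.All.Properties as All
import Data.List.Relation.Unary.Any.Properties as Any
open import Data.List.Relation.Unary.Linked as Linked using (Linked; []; [-]; _∷_)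
open import Data.Product using (_×_; _,_; ∃-syntax)
open import Data.Sum using (_⊎_; inj₁; inj₂; [_,_])
open import Function using (_∘_; _$_)
open import Relation.Nullary using (Dec; yes; no; contradiction)
open import Relation.Nullary.Reflects using (ofʸ; ofⁿ)
open import Relation.Nullary.Decidable using (_×-dec_; map′)
open import Relation.Unary using (Pred; Decidable)
open import Relation.Binary.PropositionalEquality hiding ([_])

psum : List ℕ → ℕ → ℕ
psum l j = sum (take j l)

at-beyond : ∀ l {i} → length l < i → at l i ≡ 0
at-beyond []       _                  = refl
at-beyond (x ∷ xs) {zero}        ()
at-beyond (x ∷ xs) {suc zero}    (s≤s ())
at-beyond (x ∷ xs) {suc (suc i)} (s≤s p) = at-beyond xs p

at-pos⇒≤length : ∀ l {i} → 0 < at l i → i ≤ length l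
at-pos⇒≤length l {i} p with i ≤? length l
... | yes i≤m = i≤m
... | no  i≰m = contradiction (subst (0 <_) (at-beyond l (≰⇒> i≰m)) p) λ ()

All-pos-at : ∀ {l} → All (0 <_) l → ∀ {i} → 1 ≤ i → i ≤ length l → 0 < at l i
All-pos-at []       {suc _}       _ ()
All-pos-at (px ∷ _) {suc zero}    _ _       = px
All-pos-at (_ ∷ ps) {suc (suc i)} _ (s≤s p) = All-pos-at ps (s≤s z≤n) p

psum-suc : ∀ l j → psum l (suc j) ≡ psum l j + at l (suc j)
psum-suc []       zero    = refl
psum-suc []       (suc j) = refl
psum-suc (x ∷ xs) zero    = +-comm x 0
psum-suc (x ∷ xs) (suc j) = trans (cong (x +_) (psum-suc xs j)) (sym (+-assoc x _ _))

psum-≤-sum : ∀ l j → psum l j ≤ sum l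
psum-≤-sum []       zero    = ≤-refl
psum-≤-sum []       (suc j) = ≤-refl
psum-≤-sum (x ∷ xs) zero    = z≤n
psum-≤-sum (x ∷ xs) (suc j) = +-monoʳ-≤ x (psum-≤-sum xs j)

psum-full : ∀ l {j} → length l ≤ j → psum l j ≡ sum l
psum-full l {j} m≤j = cong sum (take-all j l m≤j)

at-trim : ∀ l i → at (trim l) i ≡ at l i
at-trim []       i = refl
at-trim (x ∷ xs) i with trim xs | at-trim xs
at-trim (zero  ∷ xs) zero          | [] | _  = refl
at-trim (zero  ∷ xs) (suc zero)    | [] | _  = refl
at-trim (zero  ∷ xs) (suc (suc i)) | [] | ih = ih (suc i)
at-trim (suc x ∷ xs) zero          | [] | _  = refl
at-trim (suc x ∷ xs) (suc zero)    | [] | _  = refl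
at-trim (suc x ∷ xs) (suc (suc i)) | [] | ih = ih (suc i)
at-trim (x ∷ xs) zero              | _ ∷ _ | _  = refl
at-trim (x ∷ xs) (suc zero)        | _ ∷ _ | _  = refl
at-trim (x ∷ xs) (suc (suc i))     | _ ∷ _ | ih = ih (suc i)

sum-trim : ∀ l → sum (trim l) ≡ sum l
sum-trim []       = refl
sum-trim (x ∷ xs) with trim xs | sum-trim xs
sum-trim (zero  ∷ xs) | []    | ih = ih
sum-trim (suc x ∷ xs) | []    | ih = cong (suc x +_) ih
sum-trim (x ∷ xs)     | _ ∷ _ | ih = cong (x +_) ih

trim-suc-∷ : ∀ x l → trim (suc x ∷ l) ≡ suc x ∷ trim l
trim-suc-∷ x l with trim l
... | []    = refl
... | _ ∷ _ = refl

trim-pos : ∀ {l} → All (0 <_) l → trim l ≡ l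
trim-pos []                    = refl
trim-pos {suc x ∷ xs} (_ ∷ ps) = trans (trim-suc-∷ x xs) (cong (suc x ∷_) (trim-pos ps))

at-decRaw-≢ : ∀ l {r i} → i ≢ r → at (decRaw l r) i ≡ at l i
at-decRaw-≢ []       _ = refl
at-decRaw-≢ (x ∷ xs) {zero}                       _  = refl
at-decRaw-≢ (x ∷ xs) {suc zero}    {zero}         _  = refl
at-decRaw-≢ (x ∷ xs) {suc zero}    {suc zero}     ne = contradiction refl ne
at-decRaw-≢ (x ∷ xs) {suc zero}    {suc (suc i)}  _  = refl
at-decRaw-≢ (x ∷ xs) {suc (suc r)} {zero}         _  = refl
at-decRaw-≢ (x ∷ xs) {suc (suc r)} {suc zero}     _  = refl
at-decRaw-≢ (x ∷ xs) {suc (suc r)} {suc (suc i)}  ne = at-decRaw-≢ xs (ne ∘ cong suc)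

at-decRaw-≡ : ∀ l r → at (decRaw l r) r ≡ at l r ∸ 1
at-decRaw-≡ []       r             = refl
at-decRaw-≡ (x ∷ xs) zero          = refl
at-decRaw-≡ (x ∷ xs) (suc zero)    = refl
at-decRaw-≡ (x ∷ xs) (suc (suc r)) = at-decRaw-≡ xs (suc r)

sum-decRaw : ∀ l {r} → 1 ≤ r → 0 < at l r → sum l ≡ suc (sum (decRaw l r))
sum-decRaw []             {suc _}       _ ()
sum-decRaw (suc x ∷ xs)   {suc zero}    _ _ = refl
sum-decRaw (x ∷ xs)       {suc (suc r)} _ p =
  trans (cong (x +_) (sum-decRaw xs (s≤s z≤n) p)) (+-suc x _)

at-dec-≢ : ∀ l {r i} → i ≢ r → at (dec l r) i ≡ at l i
at-dec-≢ l {r} {i} ne = trans (at-trim (decRaw l r) i) (at-decRaw-≢ l ne)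

at-dec-≡ : ∀ l r → at (dec l r) r ≡ at l r ∸ 1
at-dec-≡ l r = trans (at-trim (decRaw l r) r) (at-decRaw-≡ l r)

at-dec-≥ : ∀ l r i → at l i ∸ 1 ≤ at (dec l r) i
at-dec-≥ l r i with i ≟ r
... | yes refl = ≤-reflexive (sym (at-dec-≡ l i))
... | no  i≢r  = ≤-trans (m∸n≤m (at l i) 1) (≤-reflexive (sym (at-dec-≢ l i≢r)))

sum-dec : ∀ l {r} → 1 ≤ r → 0 < at l r → sum l ≡ suc (sum (dec l r))
sum-dec l {r} r≥1 p = trans (sum-decRaw l r≥1 p) (cong suc (sym (sum-trim (decRaw l r))))

psum-dec-< : ∀ l {r} j → j < r → psum (dec l r) j ≡ psum l j
psum-dec-< l zero    _   = refl
psum-dec-< l (suc j) j<r = begin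
  psum (dec l _) (suc j)             ≡⟨ psum-suc (dec l _) j ⟩
  psum (dec l _) j + at (dec l _) (suc j) ≡⟨ cong₂ _+_ (psum-dec-< l j (<-trans (n<1+n j) j<r))
                                                       (at-dec-≢ l (λ { refl → <-irrefl refl j<r })) ⟩
  psum l j + at l (suc j)            ≡⟨ psum-suc l j ⟨
  psum l (suc j)                     ∎
  where open ≡-Reasoning

psum-dec-≥ : ∀ l {r} j → 1 ≤ r → r ≤ j → 0 < at l r → psum l j ≡ suc (psum (dec l r) j)
psum-dec-≥ l {suc _} zero _ () _
psum-dec-≥ l {r} (suc j) r≥1 r≤j p with m≤n⇒m<n∨m≡n r≤j
... | inj₂ refl = begin
  psum l (suc j)                               ≡⟨ psum-suc l j ⟩
  psum l j + at l (suc j)                      ≡⟨ cong₂ _+_ (psum-dec-< l j ≤-refl) at-lowered ⟨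
  psum (dec l r) j + suc (at (dec l r) (suc j)) ≡⟨ +-suc _ _ ⟩
  suc (psum (dec l r) j + at (dec l r) (suc j)) ≡⟨ cong suc (psum-suc (dec l r) j) ⟨
  suc (psum (dec l r) (suc j))                 ∎
  where
  open ≡-Reasoning
  at-lowered : suc (at (dec l r) r) ≡ at l r
  at-lowered = trans (cong suc (at-dec-≡ l r)) (trans (+-comm 1 _) (m∸n+n≡m p))
... | inj₁ (s≤s r≤j′) = begin
  psum l (suc j)                             ≡⟨ psum-suc l j ⟩
  psum l j + at l (suc j)                    ≡⟨ cong₂ _+_ (psum-dec-≥ l j r≥1 r≤j′ p)
                                                          (sym (at-dec-≢ l (λ { refl → <-irrefl refl (s≤s r≤j′) }))) ⟩
  suc (psum (dec l r) j + at (dec l r) (suc j)) ≡⟨ cong suc (psum-suc (dec l r) j) ⟨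
  suc (psum (dec l r) (suc j))               ∎
  where open ≡-Reasoning

All-pos-dec : ∀ {l} → All (0 <_) l → ∀ {i} → 1 ≤ i → at l (suc i) < at l i → All (0 <_) (dec l i)
All-pos-dec []                             _ ()
All-pos-dec {suc zero ∷ []}     (_ ∷ [])        {suc zero} _ _ = []
All-pos-dec {suc zero ∷ _ ∷ _}  (_ ∷ py ∷ _)    {suc zero} _ (s≤s y≤0) = contradiction (≤-trans py y≤0) λ ()
All-pos-dec {suc (suc k) ∷ xs}  (_ ∷ ps)        {suc zero} _ _ =
  subst (All (0 <_)) (sym (trans (trim-suc-∷ k xs) (cong (suc k ∷_) (trim-pos ps)))) (s≤s z≤n ∷ ps)
All-pos-dec {suc x ∷ xs}        (px ∷ ps)       {suc (suc i)} _ step =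
  subst (All (0 <_)) (sym (trim-suc-∷ x (decRaw xs (suc i)))) (px ∷ All-pos-dec ps (s≤s z≤n) step)

sum-insertDesc : ∀ x l → sum (insertDesc x l) ≡ x + sum l
sum-insertDesc x []       = refl
sum-insertDesc x (y ∷ ys) with y ≤ᵇ x
... | true  = refl
... | false = trans (cong (y +_) (sum-insertDesc x ys)) (x∙yz≈y∙xz y x (sum ys))

sum-sortDesc : ∀ l → sum (sortDesc l) ≡ sum l
sum-sortDesc []       = refl
sum-sortDesc (x ∷ xs) = trans (sum-insertDesc x (sortDesc xs)) (cong (x +_) (sum-sortDesc xs))

at-≤-head : ∀ {x xs} → Linked _≥_ (x ∷ xs) → ∀ i → at (x ∷ xs) i ≤ x
at-≤-head _ zero       = z≤n
at-≤-head _ (suc zero) = ≤-refl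
at-≤-head {xs = []}    _          (suc (suc i)) = z≤n
at-≤-head {xs = _ ∷ _} (x≥y ∷ d)  (suc (suc i)) = ≤-trans (at-≤-head d (suc i)) x≥y

insertDesc-below : ∀ {b} x l → x ≤ b → Linked _≥_ (b ∷ l) → Linked _≥_ (b ∷ insertDesc x l)
insertDesc-below x []       x≤b _         = x≤b ∷ [-]
insertDesc-below x (y ∷ ys) x≤b (b≥y ∷ d) with y ≤ᵇ x | ≤ᵇ-reflects-≤ y x
... | true  | ofʸ y≤x = x≤b ∷ y≤x ∷ d
... | false | ofⁿ y≰x = b≥y ∷ insertDesc-below x ys (<⇒≤ (≰⇒> y≰x)) d

insertDesc-sorted : ∀ x l → Linked _≥_ l → Linked _≥_ (insertDesc x l)
insertDesc-sorted x []       _ = [-]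
insertDesc-sorted x (y ∷ ys) d with y ≤ᵇ x | ≤ᵇ-reflects-≤ y x
... | true  | ofʸ y≤x = y≤x ∷ d
... | false | ofⁿ y≰x = insertDesc-below x ys (<⇒≤ (≰⇒> y≰x)) d

sortDesc-sorted : ∀ l → Linked _≥_ (sortDesc l)
sortDesc-sorted []       = []
sortDesc-sorted (x ∷ xs) = insertDesc-sorted x (sortDesc xs) (sortDesc-sorted xs)

psum-insertDesc : ∀ x l → Linked _≥_ l → ∀ j →
                  psum (insertDesc x l) (suc j) ≡ psum l (suc j) ⊔ (x + psum l j)
psum-insertDesc x []       _ zero    = refl
psum-insertDesc x []       _ (suc j) = refl
psum-insertDesc x (y ∷ ys) d j with y ≤ᵇ x | ≤ᵇ-reflects-≤ y x
... | true | ofʸ y≤x = sym (m≤n⇒m⊔n≡n (begin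
  psum (y ∷ ys) (suc j)                  ≡⟨ psum-suc (y ∷ ys) j ⟩
  psum (y ∷ ys) j + at (y ∷ ys) (suc j)  ≤⟨ +-monoʳ-≤ _ (≤-trans (at-≤-head d (suc j)) y≤x) ⟩
  psum (y ∷ ys) j + x                    ≡⟨ +-comm _ x ⟩
  x + psum (y ∷ ys) j                    ∎))
  where open ≤-Reasoning
... | false | ofⁿ y≰x with j
...   | zero   = sym (m≥n⇒m⊔n≡m (+-monoˡ-≤ 0 (<⇒≤ (≰⇒> y≰x))))
...   | suc j′ = begin
  y + psum (insertDesc x ys) (suc j′)        ≡⟨ cong (y +_) (psum-insertDesc x ys (Linked.tail d) j′) ⟩
  y + (psum ys (suc j′) ⊔ (x + psum ys j′))   ≡⟨ +-distribˡ-⊔ y _ _ ⟩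
  (y + psum ys (suc j′)) ⊔ (y + (x + psum ys j′)) ≡⟨ cong ((y + psum ys (suc j′)) ⊔_) (x∙yz≈y∙xz y x _) ⟩
  (y + psum ys (suc j′)) ⊔ (x + (y + psum ys j′)) ∎
  where open ≡-Reasoning

LowerStep : ℕ → ℕ → ℕ → ℕ → Set
LowerStep c A X A′ = A′ ≤ A × (A′ < A ⊎ A + c ≤ X)

-- What survives of "λ(ã) is λ(a) with a part a_h lowered by one" in terms of prefix sums,
-- in a form that insertion preserves.
LowersPrefixes : ℕ → List ℕ → List ℕ → Set
LowersPrefixes c u v = ∀ j → LowerStep c (psum u j) (psum u (suc j)) (psum v j)

+-lowerStep : ∀ x {c A X A′} → LowerStep c A X A′ → LowerStep c (x + A) (x + X) (x + A′)
+-lowerStep x (A′≤A , inj₁ A′<A) = +-monoʳ-≤ x A′≤A , inj₁ (+-monoʳ-< x A′<A)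
+-lowerStep x {c} {A} {X} (A′≤A , inj₂ gap) =
  +-monoʳ-≤ x A′≤A , inj₂ (subst (_≤ x + X) (sym (+-assoc x A c)) (+-monoʳ-≤ x gap))

⊔-lowerStep : ∀ {c A X A′ B Y B′} → LowerStep c A X A′ → LowerStep c B Y B′ →
              LowerStep c (A ⊔ B) (X ⊔ Y) (A′ ⊔ B′)
⊔-lowerStep {c} {A} {X} {A′} {B} {Y} {B′} (A′≤A , a) (B′≤B , b) = ⊔-mono-≤ A′≤A B′≤B , step a b
  where
  step : A′ < A ⊎ A + c ≤ X → B′ < B ⊎ B + c ≤ Y → A′ ⊔ B′ < A ⊔ B ⊎ A ⊔ B + c ≤ X ⊔ Y
  step (inj₁ A′<A) (inj₁ B′<B) = inj₁ (⊔-mono-< A′<A B′<B)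
  step (inj₂ gapA) (inj₂ gapB) = inj₂ (subst (_≤ X ⊔ Y) (sym (+-distribʳ-⊔ c A B)) (⊔-mono-≤ gapA gapB))
  step (inj₁ A′<A) (inj₂ gapB) with B <? A
  ... | yes B<A = inj₁ (<-≤-trans (⊔-lub A′<A (≤-<-trans B′≤B B<A)) (m≤m⊔n A B))
  ... | no  B≮A = inj₂ (subst (λ m → m + c ≤ X ⊔ Y) (sym (m≤n⇒m⊔n≡n (≮⇒≥ B≮A))) (≤-trans gapB (m≤n⊔m X Y)))
  step (inj₂ gapA) (inj₁ B′<B) with A <? B
  ... | yes A<B = inj₁ (<-≤-trans (⊔-lub (≤-<-trans A′≤A A<B) B′<B) (m≤n⊔m A B))
  ... | no  A≮B = inj₂ (subst (λ m → m + c ≤ X ⊔ Y) (sym (m≥n⇒m⊔n≡m (≮⇒≥ A≮B))) (≤-trans gapA (m≤m⊔n X Y)))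

insertDesc-lowers : ∀ x {c u v} → Linked _≥_ u → Linked _≥_ v →
                    LowersPrefixes c u v → LowersPrefixes c (insertDesc x u) (insertDesc x v)
insertDesc-lowers x {c} {u} du dv low zero with low 0
... | _ , inj₁ ()
... | _ , inj₂ c≤u₁ = z≤n , inj₂ (subst (c ≤_) (sym (psum-insertDesc x u du 0)) (≤-trans c≤u₁ (m≤m⊔n _ _)))
insertDesc-lowers x {c} {u} {v} du dv low (suc j)
  rewrite psum-insertDesc x u du j | psum-insertDesc x v dv j | psum-insertDesc x u du (suc j) =
  ⊔-lowerStep (low (suc j)) (+-lowerStep x (low j))

tilde-∷ : ∀ x y ys → tilde (x ∷ y ∷ ys) ≡ x ∷ tilde (y ∷ ys)
tilde-∷ zero          y ys = refl
tilde-∷ (suc zero)    y ys = refl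
tilde-∷ (suc (suc x)) y ys = refl

sum-tilde : ∀ l → 1 ≤ lastPart l → sum l ≡ suc (sum (tilde l))
sum-tilde (suc zero ∷ [])    _ = refl
sum-tilde (suc (suc k) ∷ []) _ = refl
sum-tilde (x ∷ y ∷ ys)       p = begin
  x + sum (y ∷ ys)              ≡⟨ cong (x +_) (sum-tilde (y ∷ ys) p) ⟩
  x + suc (sum (tilde (y ∷ ys))) ≡⟨ +-suc x _ ⟩
  suc (sum (x ∷ tilde (y ∷ ys))) ≡⟨ cong (suc ∘ sum) (tilde-∷ x y ys) ⟨
  suc (sum (tilde (x ∷ y ∷ ys))) ∎
  where open ≡-Reasoning

lastPart-tilde : ∀ l → 2 ≤ lastPart l → lastPart (tilde l) ≡ lastPart l ∸ 1
lastPart-tilde (suc (suc k) ∷ [])     _ = refl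
lastPart-tilde (suc zero ∷ [])        (s≤s ())
lastPart-tilde (x ∷ suc zero ∷ [])    (s≤s ())
lastPart-tilde (x ∷ suc (suc k) ∷ []) _ rewrite tilde-∷ x (suc (suc k)) [] = refl
lastPart-tilde (x ∷ y ∷ z ∷ zs)       p = begin
  lastPart (tilde (x ∷ y ∷ z ∷ zs)) ≡⟨ cong lastPart (tilde-∷ x y (z ∷ zs)) ⟩
  lastPart (x ∷ tilde (y ∷ z ∷ zs)) ≡⟨ cong (lastPart ∘ (x ∷_)) (tilde-∷ y z zs) ⟩
  lastPart (y ∷ tilde (z ∷ zs))     ≡⟨ cong lastPart (tilde-∷ y z zs) ⟨
  lastPart (tilde (y ∷ z ∷ zs))     ≡⟨ lastPart-tilde (y ∷ z ∷ zs) p ⟩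
  lastPart (z ∷ zs) ∸ 1             ∎
  where open ≡-Reasoning

lastPart-tilde-pos : ∀ l → 2 ≤ lastPart l → 1 ≤ lastPart (tilde l)
lastPart-tilde-pos l p = subst (1 ≤_) (sym (lastPart-tilde l p)) (∸-monoˡ-≤ 1 p)

sortDesc-tilde-lowers : ∀ a → 1 ≤ lastPart a → LowersPrefixes (lastPart a) (sortDesc a) (sortDesc (tilde a))
sortDesc-tilde-lowers (suc zero ∷ [])    _ zero    = z≤n , inj₂ ≤-refl
sortDesc-tilde-lowers (suc zero ∷ [])    _ (suc j) = z≤n , inj₁ (s≤s z≤n)
sortDesc-tilde-lowers (suc (suc k) ∷ []) _ zero    = z≤n , inj₂ (≤-reflexive (sym (+-identityʳ _)))
sortDesc-tilde-lowers (suc (suc k) ∷ []) _ (suc j) = n≤1+n _ , inj₁ ≤-refl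
sortDesc-tilde-lowers (x ∷ y ∷ ys)       p =
  subst (LowersPrefixes (lastPart (y ∷ ys)) (sortDesc (x ∷ y ∷ ys)) ∘ sortDesc) (sym (tilde-∷ x y ys)) $
  insertDesc-lowers x (sortDesc-sorted (y ∷ ys)) (sortDesc-sorted (tilde (y ∷ ys))) (sortDesc-tilde-lowers (y ∷ ys) p)

sIdx-term : List ℕ → List ℕ → ℕ → ℕ
sIdx-term ν b i = if lastPart b ≤ᵇ at ν i then i else 0

sIdx-term-≤ : ∀ ν b i → sIdx-term ν b i ≤ i
sIdx-term-≤ ν b i with lastPart b ≤ᵇ at ν i
... | true  = ≤-refl
... | false = z≤n

sIdx-term-at : ∀ ν b i → 1 ≤ sIdx-term ν b i → lastPart b ≤ at ν (sIdx-term ν b i)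
sIdx-term-at ν b i with lastPart b ≤ᵇ at ν i | ≤ᵇ-reflects-≤ (lastPart b) (at ν i)
... | true | ofʸ c≤νᵢ = λ _ → c≤νᵢ

sIdx-term-≡ : ∀ ν b {i} → lastPart b ≤ at ν i → sIdx-term ν b i ≡ i
sIdx-term-≡ ν b {i} c≤νᵢ with lastPart b ≤ᵇ at ν i | ≤ᵇ-reflects-≤ (lastPart b) (at ν i)
... | true  | _        = refl
... | false | ofⁿ c≰νᵢ = contradiction c≤νᵢ c≰νᵢ

sIdx-maximal : ∀ ν b {i} → 1 ≤ i → i ≤ length ν → lastPart b ≤ at ν i → i ≤ sIdx ν b
sIdx-maximal ν b {suc k} _ i≤m c≤νᵢ =
  foldr-preservesᵒ {P = suc k ≤_} (λ x y → [ m≤n⇒m≤n⊔o y , m≤n⇒m≤o⊔n x ]) 0 _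
    (inj₂ (Any.map⁺ (Any.applyUpTo⁺ suc (≤-reflexive (sym (sIdx-term-≡ ν b c≤νᵢ))) i≤m)))

sIdx-≤-length : ∀ ν b → sIdx ν b ≤ length ν
sIdx-≤-length ν b = foldr-preservesᵇ {P = _≤ length ν} ⊔-lub z≤n
  (All.map⁺ (All.applyUpTo⁺₁ suc (length ν) (λ {i} i<m → ≤-trans (sIdx-term-≤ ν b (suc i)) i<m)))

sIdx-at : ∀ ν b → 1 ≤ sIdx ν b → lastPart b ≤ at ν (sIdx ν b)
sIdx-at ν b = foldr-preservesᵇ {P = P} keep (λ ()) (All.map⁺ (All.applyUpTo⁺₂ suc (length ν) (sIdx-term-at ν b ∘ suc)))
  where
  P : ℕ → Set
  P x = 1 ≤ x → lastPart b ≤ at ν x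
  keep : ∀ {x y} → P x → P y → P (x ⊔ y)
  keep {x} {y} px py with ⊔-sel x y
  ... | inj₁ e = subst P (sym e) px
  ... | inj₂ e = subst P (sym e) py

sIdx-beyond : ∀ ν b {i} → 1 ≤ lastPart b → sIdx ν b < i → at ν i < lastPart b
sIdx-beyond ν b {i} c≥1 s<i with at ν i <? lastPart b
... | yes νᵢ<c = νᵢ<c
... | no  νᵢ≮c = contradiction
  (sIdx-maximal ν b (≤-trans (s≤s z≤n) s<i) (at-pos⇒≤length ν (≤-trans c≥1 (≮⇒≥ νᵢ≮c))) (≮⇒≥ νᵢ≮c))
  (<⇒≱ s<i)

⊵⇒psum-≤ : ∀ {x y} → sum x ≡ sum y → x ⊵ y → ∀ j → psum y j ≤ psum x j
⊵⇒psum-≤         _  _         zero    = z≤n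
⊵⇒psum-≤ {x} {y} Σ≡ (_ , dom) (suc j) with suc j ≤? length x
... | yes j<m = dom (suc j) (s≤s z≤n) j<m
... | no  j≮m = begin
  psum y (suc j) ≤⟨ psum-≤-sum y (suc j) ⟩
  sum y          ≡⟨ Σ≡ ⟨
  sum x          ≡⟨ psum-full x (<⇒≤ (≰⇒> j≮m)) ⟨
  psum x (suc j) ∎
  where open ≤-Reasoning

psum-≤⇒⊵ : ∀ {x y} → All (0 <_) x → sum x ≡ sum y → (∀ j → psum y j ≤ psum x j) → x ⊵ y
psum-≤⇒⊵ {x} {y} x⁺ Σ≡ dom = length-≤ , λ j _ _ → dom j
  where
  -- otherwise the prefix sums of x would already reach sum x before its last (positive) part
  length-≤ : length x ≤ length y
  length-≤ with length x ≤? length y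
  ... | yes m≤n = m≤n
  ... | no  m≰n = contradiction (begin-strict
    sum x                   ≡⟨ Σ≡ ⟩
    sum y                   ≡⟨ psum-full y ≤-refl ⟨
    psum y n                ≤⟨ dom n ⟩
    psum x n                <⟨ m<m+n (psum x n) (All-pos-at x⁺ (s≤s z≤n) (≰⇒> m≰n)) ⟩
    psum x n + at x (suc n) ≡⟨ psum-suc x n ⟨
    psum x (suc n)          ≤⟨ psum-≤-sum x (suc n) ⟩
    sum x                   ∎) (<-irrefl refl)
    where
    open ≤-Reasoning
    n = length y

bounded-∀? : ∀ {p} {P : Pred ℕ p} → Decidable P → ∀ n → Dec (∀ j → 1 ≤ j → j ≤ n → P j)
bounded-∀? {P = P} P? n = map′ fromAll toAll (all? P? (applyUpTo suc n))
  where
  fromAll : All P (applyUpTo suc n) → ∀ j → 1 ≤ j → j ≤ n → P j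
  fromAll all (suc j) _ j<n = All.applyUpTo⁻ suc n all j<n
  toAll : (∀ j → 1 ≤ j → j ≤ n → P j) → All P (applyUpTo suc n)
  toAll ∀P = All.applyUpTo⁺₁ suc n (λ j<n → ∀P _ (s≤s z≤n) j<n)

_⊵?_ : ∀ x y → Dec (x ⊵ y)
x ⊵? y = (length x ≤? length y) ×-dec bounded-∀? (λ j → psum y j ≤? psum x j) (length x)

InR? : ∀ ν b → Decidable (InR ν b)
InR? ν b i = (1 ≤? i) ×-dec (i ≤? length ν) ×-dec (at ν (suc i) <? at ν i) ×-dec (dec ν i ⊵? sortDesc (tilde b))

LeastFrom : ∀ {p} → Pred ℕ p → ℕ → ℕ → Set p
LeastFrom P i l = (P l × i ≤ l) × (∀ k → P k → i ≤ k → l ≤ k)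

least-from : ∀ {p} {P : Pred ℕ p} → Decidable P → ∀ i d → P (i + d) → ∃[ l ] (LeastFrom P i l × l ≤ i + d)
least-from P? i d p with P? i
... | yes pᵢ = i , ((pᵢ , ≤-refl) , λ _ _ i≤k → i≤k) , m≤m+n i d
least-from {P = P} P? i zero p | no ¬pᵢ = contradiction (subst P (+-identityʳ i) p) ¬pᵢ
least-from {P = P} P? i (suc d) p | no ¬pᵢ with least-from P? (suc i) d (subst P (+-suc i d) p)
... | l , ((pₗ , i<l) , least) , l≤ = l , ((pₗ , <⇒≤ i<l) , least′) , subst (l ≤_) (sym (+-suc i d)) l≤
  where
  least′ : ∀ k → P k → i ≤ k → l ≤ k
  least′ k pₖ i≤k with m≤n⇒m<n∨m≡n i≤k
  ... | inj₁ i<k  = least k pₖ i<k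
  ... | inj₂ refl = contradiction pₖ ¬pᵢ

least-between : ∀ {p} {P : Pred ℕ p} → Decidable P → ∀ {i q} → i ≤ q → P q → ∃[ l ] (LeastFrom P i l × l ≤ q)
least-between {P = P} P? {i} {q} i≤q p =
  subst (λ m → ∃[ l ] (LeastFrom P i l × l ≤ m)) (m+[n∸m]≡n i≤q)
    (least-from P? i (q ∸ i) (subst P (sym (m+[n∸m]≡n i≤q)) p))

sIdx-dec-tilde : ∀ μ a r → 2 ≤ lastPart a → 1 ≤ sIdx μ a → sIdx μ a ≤ sIdx (dec μ r) (tilde a)
sIdx-dec-tilde μ a r aₕ≥2 s≥1 =
  sIdx-maximal (dec μ r) (tilde a) s≥1 (at-pos⇒≤length (dec μ r) (≤-trans (lastPart-tilde-pos a aₕ≥2) c≤νₛ)) c≤νₛ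
  where
  s = sIdx μ a
  c≤νₛ : lastPart (tilde a) ≤ at (dec μ r) s
  c≤νₛ = begin
    lastPart (tilde a) ≡⟨ lastPart-tilde a aₕ≥2 ⟩
    lastPart a ∸ 1     ≤⟨ ∸-monoˡ-≤ 1 (sIdx-at μ a s≥1) ⟩
    at μ s ∸ 1         ≤⟨ at-dec-≥ μ r s ⟩
    at (dec μ r) s     ∎
    where open ≤-Reasoning

module _ {ν b : List ℕ} (ν⁺ : All (0 <_) ν) (Σ≡ : sum ν ≡ sum b) (c≥1 : 1 ≤ lastPart b)
         (ν⊵ : ν ⊵ sortDesc b) (s≥1 : 1 ≤ sIdx ν b) where

  private
    c  = lastPart b
    s  = sIdx ν b
    λb  = sortDesc b
    λb′ = sortDesc (tilde b)

  sIdx-corner : at ν (suc s) < at ν s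
  sIdx-corner = <-≤-trans (sIdx-beyond ν b c≥1 (n<1+n s)) (sIdx-at ν b s≥1)

  dec-sIdx-⊵ : dec ν s ⊵ λb′
  dec-sIdx-⊵ = psum-≤⇒⊵ (All-pos-dec ν⁺ s≥1 sIdx-corner) Σ≡′ psum-≤
    where
    νₛ>0 : 0 < at ν s
    νₛ>0 = ≤-trans c≥1 (sIdx-at ν b s≥1)
    dom : ∀ j → psum λb j ≤ psum ν j
    dom = ⊵⇒psum-≤ (trans Σ≡ (sym (sum-sortDesc b))) ν⊵
    Σ≡′ : sum (dec ν s) ≡ sum λb′
    Σ≡′ = suc-injective (begin
      suc (sum (dec ν s)) ≡⟨ sum-dec ν s≥1 νₛ>0 ⟨
      sum ν               ≡⟨ Σ≡ ⟩
      sum b               ≡⟨ sum-tilde b c≥1 ⟩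
      suc (sum (tilde b)) ≡⟨ cong suc (sum-sortDesc (tilde b)) ⟨
      suc (sum λb′)       ∎)
      where open ≡-Reasoning
    psum-≤ : ∀ j → psum λb′ j ≤ psum (dec ν s) j
    psum-≤ j with j <? s | sortDesc-tilde-lowers b c≥1 j
    ... | yes j<s | b′≤b , _ = begin
      psum λb′ j       ≤⟨ b′≤b ⟩
      psum λb j        ≤⟨ dom j ⟩
      psum ν j         ≡⟨ psum-dec-< ν j j<s ⟨
      psum (dec ν s) j ∎
      where open ≤-Reasoning
    ... | no j≮s | b′≤b , next = m<1+n⇒m≤n (subst (psum λb′ j <_) (psum-dec-≥ ν j s≥1 (≮⇒≥ j≮s) νₛ>0) (strict next))
      where
      -- past s every part of ν is below c, so λ(b) cannot gain c on ν in one step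
      strict : psum λb′ j < psum λb j ⊎ psum λb j + c ≤ psum λb (suc j) → psum λb′ j < psum ν j
      strict (inj₁ b′<b) = <-≤-trans b′<b (dom j)
      strict (inj₂ gap)  = ≤-<-trans b′≤b (+-cancelʳ-< c (psum λb j) (psum ν j) (begin-strict
        psum λb j + c           ≤⟨ gap ⟩
        psum λb (suc j)         ≤⟨ dom (suc j) ⟩
        psum ν (suc j)          ≡⟨ psum-suc ν j ⟩
        psum ν j + at ν (suc j) <⟨ +-monoʳ-< (psum ν j) (sIdx-beyond ν b c≥1 (s≤s (≮⇒≥ j≮s))) ⟩
        psum ν j + c            ∎))
        where open ≤-Reasoning

  sIdx-∈R : InR ν b s
  sIdx-∈R = s≥1 , sIdx-≤-length ν b , sIdx-corner , dec-sIdx-⊵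

lemma5p3 : (n : ℕ) (μ a : List ℕ) (r : ℕ) →
    IsPartition n μ → IsComposition n a → μ ⊵ sortDesc a →
    2 ≤ lastPart a → InR μ a r → r ≤ sIdx μ a →
    sIdx μ a ≤ sIdx (dec μ r) (tilde a)
    × (∃[ l ] (IsMinR (dec μ r) (tilde a) r l × l ≤ sIdx (dec μ r) (tilde a)))
lemma5p3 n μ a r ((μ⁺ , Σμ) , _) (_ , Σa) _ aₕ≥2 (r≥1 , _ , μ-corner , ν⊵) r≤s =
  s≤s′ , least-between (InR? ν (tilde a)) (≤-trans r≤s s≤s′) s′∈R
  where
  ν = dec μ r
  s≤s′ : sIdx μ a ≤ sIdx ν (tilde a)
  s≤s′ = sIdx-dec-tilde μ a r aₕ≥2 (≤-trans r≥1 r≤s)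
  Σν≡Σã : sum ν ≡ sum (tilde a)
  Σν≡Σã = suc-injective (begin
    suc (sum ν)         ≡⟨ sum-dec μ r≥1 (≤-trans (s≤s z≤n) μ-corner) ⟨
    sum μ               ≡⟨ trans Σμ (sym Σa) ⟩
    sum a               ≡⟨ sum-tilde a (≤-trans (s≤s z≤n) aₕ≥2) ⟩
    suc (sum (tilde a)) ∎)
    where open ≡-Reasoning
  s′∈R : InR ν (tilde a) (sIdx ν (tilde a))
  s′∈R = sIdx-∈R {ν} {tilde a} (All-pos-dec μ⁺ r≥1 μ-corner) Σν≡Σã (lastPart-tilde-pos a aₕ≥2) ν⊵
    (≤-trans (≤-trans r≥1 r≤s) s≤s′)
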